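{- Let $R$ be a confluent EPRF-TRS over a ranked alphabet $\Sigma$ and let $p,q\in T_\Sigma(X)$. Then it is decidable whether $p\Leftrightarrow^*_R q$.
   Context: A ranked alphabet $\Sigma$ is a finite set of symbols with ranks; $X=\{x_1,x_2,\dots\}$ is a countable set of variables, $T_\Sigma(X)$ the terms over $\Sigma$ and $X$, $T_\Sigma$ the ground terms. A TRS $R$ over $\Sigma$ is a finite set of rules $l\to r$, $l,r\in T_\Sigma(X)$, with every variable of $r$ occurring in $l$; $\Rightarrow_R$ is the rewrite relation on $T_\Sigma(X)$, $\Rightarrow^*_R$ its reflexive transitive closure, and $\Leftrightarrow^*_R$ the reflexive, symmetric, transitive closure of $\Rightarrow_R$; $sign(R)$ is the set of symbols occurring in the rules. $R$ is confluent if $t\Rightarrow^*_R t_1$, $t\Rightarrow^*_R t_2$ imply a common reduct of $t_1,t_2$. For $L\subseteq T_\Sigma$, $R^*_\Sigma(L)=\{p\mid q\Rightarrow^*_R p,\ q\in L\}$. A bottom-up tree automaton (bta) over $\Sigma$ is a finite automaton with states (treated as constants), final states, rules $\delta(a_1,\dots,a_n)\to a$ and $a\to a'$; it recognizes the ground terms rewriting to a final state. $R$ is an EPRF-TRS if for any given ranked alphabet $\Sigma\supseteq sign(R)$ and finite $L\subseteq T_\Sigma$ one can effectively construct a bta $\mathcal{C}$ over $\Sigma$ with $L(\mathcal{C})=R^*_\Sigma(L)$. -}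

module Defs where

open import Data.Nat using (ℕ)
open import Data.Fin using (Fin)
open import Data.List using (List; []; _∷_; _++_; map; concatMap)
open import Data.List.Membership.Propositional using (_∈_; _∉_)
open import Data.List.Relation.Binary.Subset.Propositional using (_⊆_)
open import Data.Vec using (Vec; []; _∷_; lookup; _[_]≔_)
import Data.Vec as V
open import Data.Vec.Relation.Unary.All using () renaming (All to VAll)
open import Data.List.Relation.Unary.All using (All)
open import Data.Product using (Σ; ∃; ∃-syntax; _×_; _,_)
open import Relation.Binary.PropositionalEquality using (_≡_)
open import Relation.Binary.Construct.Closure.ReflexiveTransitive using (Star)
open import Relation.Binary.Construct.Closure.Equivalence using (EqClosure)

record Sym : Set where
  constructor mkSym
  field
    name  : ℕ
    arity : ℕ
open Sym public

Alphabet : Set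
Alphabet = List Sym

-- Terms over all symbols and the variables X = {x_0, x_1, ...}.
data Term : Set where
  var : ℕ → Term
  fun : (f : Sym) → Vec Term (arity f) → Term

mutual
  symbols : Term → List Sym
  symbols (var x)    = []
  symbols (fun f ts) = f ∷ symbolss ts

  symbolss : ∀ {n} → Vec Term n → List Sym
  symbolss []       = []
  symbolss (t ∷ ts) = symbols t ++ symbolss ts

mutual
  vars : Term → List ℕ
  vars (var x)    = x ∷ []
  vars (fun f ts) = varss ts

  varss : ∀ {n} → Vec Term n → List ℕ
  varss []       = []
  varss (t ∷ ts) = vars t ++ varss ts

InT : Alphabet → Term → Set
InT Σ' t = symbols t ⊆ Σ'

Ground : Alphabet → Term → Set
Ground Σ' t = InT Σ' t × vars t ≡ []

Subst : Set
Subst = ℕ → Term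

mutual
  _⟨_⟩ : Term → Subst → Term
  var x ⟨ σ ⟩    = σ x
  fun f ts ⟨ σ ⟩ = fun f (substs ts σ)

  substs : ∀ {n} → Vec Term n → Subst → Vec Term n
  substs []       σ = []
  substs (t ∷ ts) σ = (t ⟨ σ ⟩) ∷ substs ts σ

record Rule : Set where
  constructor _⟶_∣_
  field
    lhs    : Term
    rhs    : Term
    varsOK : vars rhs ⊆ vars lhs
open Rule public

TRS : Set
TRS = List Rule

sign : TRS → List Sym
sign []      = []
sign (ρ ∷ R) = symbols (lhs ρ) ++ symbols (rhs ρ) ++ sign R

data Step (R : TRS) : Term → Term → Set where
  root : ∀ {ρ} → ρ ∈ R → (σ : Subst) → Step R (lhs ρ ⟨ σ ⟩) (rhs ρ ⟨ σ ⟩)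
  arg  : ∀ f (ts : Vec Term (arity f)) (i : Fin (arity f)) {t'} →
         Step R (lookup ts i) t' → Step R (fun f ts) (fun f (ts [ i ]≔ t'))

_⇒*[_]_ : Term → TRS → Term → Set
s ⇒*[ R ] t = Star (Step R) s t

_⇔*[_]_ : Term → TRS → Term → Set
s ⇔*[ R ] t = EqClosure (Step R) s t

TRSOver : Alphabet → TRS → Set
TRSOver Σ' R = sign R ⊆ Σ'

Confluent : Alphabet → TRS → Set
Confluent Σ' R = ∀ t t₁ t₂ → InT Σ' t → t ⇒*[ R ] t₁ → t ⇒*[ R ] t₂ →
                 ∃[ u ] (t₁ ⇒*[ R ] u × t₂ ⇒*[ R ] u)

-- Bottom-up tree automata. States are constants (rank-0 symbols with
-- names in ℕ), disjoint from Σ.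

stSym : ℕ → Sym
stSym a = mkSym a 0

st : ℕ → Term
st a = fun (stSym a) []

data BRule (Σ' : Alphabet) (Q : List ℕ) : Set where
  δrule : (δ : Sym) → δ ∈ Σ' → (as : Vec ℕ (arity δ)) → VAll (_∈ Q) as →
          (a : ℕ) → a ∈ Q → BRule Σ' Q
  εrule : (a a' : ℕ) → a ∈ Q → a' ∈ Q → BRule Σ' Q

toRule : ∀ {Σ' Q} → BRule Σ' Q → Rule
toRule (δrule δ _ as _ a _) = fun δ (V.map st as) ⟶ st a ∣ (λ ())
toRule (εrule a a' _ _)     = st a ⟶ st a' ∣ (λ ())

record BTA (Σ' : Alphabet) : Set where
  field
    states   : List ℕ
    disjoint : ∀ a → a ∈ states → stSym a ∉ Σ'
    final    : List ℕ
    final⊆   : final ⊆ states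
    rules    : List (BRule Σ' states)

  asTRS : TRS
  asTRS = map toRule rules

Accepts : ∀ {Σ'} → BTA Σ' → Term → Set
Accepts {Σ'} C t = Ground Σ' t × ∃[ a ] (a ∈ BTA.final C × t ⇒*[ BTA.asTRS C ] st a)

Descendant : TRS → List Term → Term → Set
Descendant R L p = ∃[ q ] (q ∈ L × q ⇒*[ R ] p)

-- EPRF-TRS: effective construction (a function) of a bta for every
-- Σ ⊇ sign(R) and every finite L ⊆ T_Σ.
EPRF : TRS → Set
EPRF R = (Σ' : Alphabet) → sign R ⊆ Σ' → (L : List Term) → All (Ground Σ') L →
         Σ (BTA Σ') λ C → ∀ t → (Accepts C t → Descendant R L t) × (Descendant R L t → Accepts C t)

module Submission where

-- The decision is assembled from three equivalences.
--  (1) Church–Rosser: p ⇔*_R q iff p and q are joinable.  Confluence is only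
--      assumed on T_Σ(X), but a conversion may pass through terms with
--      foreign symbols; the renaming π that replaces every foreign symbol by
--      a variable fixes the rules of R and maps the conversion into T_Σ(X).
--  (2) Freezing: substituting fresh constants for the variables of p and q
--      gives ground terms p̂, q̂ over an extended alphabet Σ̂, and p, q are
--      joinable iff p̂, q̂ are; the renaming ν that thaws the constants back
--      into variables gives the converse.
--  (3) Automata: EPRF yields btas C₁, C₂ over Σ̂ recognising the descendants
--      of p̂ and q̂, so p̂ and q̂ are joinable iff L(C₁) ∩ L(C₂) ≠ ∅.  This is
--      decidable: the pairs of states reached by a common ground term form
--      the least set closed under the product rules, computed by saturation.

open import Defs
open import Function using (_∘_; _⇔_; mk⇔)
open import Data.Nat as ℕ using (ℕ; zero; suc; _+_; _∸_; _≤_; _<_; _⊓_; z≤n; s≤s)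
import Data.Nat.Properties as ℕP
open import Data.Fin using (Fin; zero; suc)
import Data.Fin.Properties as FinP
open import Data.List as List using (List; []; _∷_; _++_)
open import Data.List.Membership.Propositional using (_∈_; _∉_; find; lose)
import Data.List.Membership.Propositional.Properties as ∈P
import Data.List.Membership.DecPropositional as DecMembership
open import Data.List.Relation.Unary.Any using (Any; here; there; any?)
open import Data.List.Relation.Unary.All using ([]; _∷_)
import Data.List.Relation.Unary.All as All
open import Data.List.Relation.Binary.Subset.Propositional using (_⊆_)
open import Data.List.Extrema.Nat using (max; xs≤max)
open import Data.Vec as Vec using (Vec; []; _∷_; lookup; _[_]≔_)
import Data.Vec.Properties as VecP
open import Data.Vec.Relation.Unary.All using () renaming (All to VAll)
import Data.Vec.Relation.Unary.All.Properties as VAllP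
import Data.Vec.Relation.Binary.Pointwise.Inductive as Pointwise
open import Data.Vec.Relation.Binary.Pointwise.Extensional using (ext; extensional⇒inductive)
open import Data.Product using (Σ; ∃-syntax; _×_; _,_; proj₁; proj₂)
open import Data.Product.Properties using (≡-dec)
open import Data.Sum using (_⊎_; inj₁; inj₂)
open import Data.Empty using (⊥; ⊥-elim)
open import Data.Maybe using (Maybe; just; nothing)
open import Relation.Nullary using (Dec; yes; no; contradiction)
open import Relation.Nullary.Decidable as Dec using (map′; _×-dec_; _⊎-dec_; ¬?; decidable-stable)
open import Relation.Binary.Definitions using (DecidableEquality)
open import Relation.Binary.PropositionalEquality
open import Relation.Binary.Construct.Closure.ReflexiveTransitive using (ε; _◅_; _◅◅_)
open import Relation.Binary.Construct.Closure.Symmetric using (fwd; bwd)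
open import Relation.Binary.Construct.Closure.Equivalence.Properties using (a—↠b⇒a↔b; a—↠b⇒b↔a)

_≟S_ : DecidableEquality Sym
mkSym n a ≟S mkSym m b =
  map′ (λ { (refl , refl) → refl }) (λ { refl → refl , refl }) (n ℕ.≟ m ×-dec a ℕ.≟ b)

_∈S?_ : (f : Sym) (fs : List Sym) → Dec (f ∈ fs)
_∈S?_ = DecMembership._∈?_ _≟S_

Joinable : TRS → Term → Term → Set
Joinable R s t = ∃[ u ] (s ⇒*[ R ] u × t ⇒*[ R ] u)

joinable⇒convertible : ∀ {R s t} → Joinable R s t → s ⇔*[ R ] t
joinable⇒convertible (_ , s⇒*u , t⇒*u) = a—↠b⇒a↔b s⇒*u ◅◅ a—↠b⇒b↔a t⇒*u

⇒?⇒⇒* : ∀ {R s t} → s ≡ t ⊎ Step R s t → s ⇒*[ R ] t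
⇒?⇒⇒* (inj₁ refl) = ε
⇒?⇒⇒* (inj₂ step) = step ◅ ε

lhs⊆sign : ∀ R {ρ} → ρ ∈ R → symbols (lhs ρ) ⊆ sign R
lhs⊆sign (ρ ∷ R) (here refl) = ∈P.∈-++⁺ˡ
lhs⊆sign (ρ ∷ R) (there ρ∈R) =
  ∈P.∈-++⁺ʳ (symbols (lhs ρ)) ∘ ∈P.∈-++⁺ʳ (symbols (rhs ρ)) ∘ lhs⊆sign R ρ∈R

rhs⊆sign : ∀ R {ρ} → ρ ∈ R → symbols (rhs ρ) ⊆ sign R
rhs⊆sign (ρ ∷ R) (here refl) = ∈P.∈-++⁺ʳ (symbols (lhs ρ)) ∘ ∈P.∈-++⁺ˡ
rhs⊆sign (ρ ∷ R) (there ρ∈R) =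
  ∈P.∈-++⁺ʳ (symbols (lhs ρ)) ∘ ∈P.∈-++⁺ʳ (symbols (rhs ρ)) ∘ rhs⊆sign R ρ∈R

symbols-lookup : ∀ {n} (ts : Vec Term n) i → symbols (lookup ts i) ⊆ symbolss ts
symbols-lookup (t ∷ ts) zero    = ∈P.∈-++⁺ˡ
symbols-lookup (t ∷ ts) (suc i) = ∈P.∈-++⁺ʳ (symbols t) ∘ symbols-lookup ts i

ground-fun : ∀ {Σ'} f (ts : Vec Term (arity f)) → f ∈ Σ' →
             (∀ i → Ground Σ' (lookup ts i)) → Ground Σ' (fun f ts)
ground-fun {Σ'} f ts f∈Σ' args = symbols-fun , varss-ground ts (proj₂ ∘ args)
  where
  symbolss-in : ∀ {n} (us : Vec Term n) → (∀ i → InT Σ' (lookup us i)) → symbolss us ⊆ Σ'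
  symbolss-in (u ∷ us) h g∈ with ∈P.∈-++⁻ (symbols u) g∈
  ... | inj₁ g∈u  = h zero g∈u
  ... | inj₂ g∈us = symbolss-in us (h ∘ suc) g∈us
  varss-ground : ∀ {n} (us : Vec Term n) → (∀ i → vars (lookup us i) ≡ []) → varss us ≡ []
  varss-ground []       h = refl
  varss-ground (u ∷ us) h rewrite h zero = varss-ground us (h ∘ suc)
  symbols-fun : InT Σ' (fun f ts)
  symbols-fun (here refl) = f∈Σ'
  symbols-fun (there g∈)  = symbolss-in ts (proj₁ ∘ args) g∈

at-tabulate : ∀ {n} (P : Fin n → Term → Set) (f : Fin n → Term) →
              (∀ i → P i (f i)) → ∀ i → P i (lookup (Vec.tabulate f) i)
at-tabulate P f holds i = subst (P i) (sym (VecP.lookup∘tabulate f i)) (holds i)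

⇒*-context : ∀ {R n} (F : Vec Term n → Term) →
  (∀ vs i {u} → Step R (lookup vs i) u → Step R (F vs) (F (vs [ i ]≔ u))) →
  (ts us : Vec Term n) → (∀ i → lookup ts i ⇒*[ R ] lookup us i) → F ts ⇒*[ R ] F us
⇒*-context F compat []       []       _    = ε
⇒*-context {R} F compat (t ∷ ts) (u ∷ us) args =
  head-⇒* (args zero) ◅◅
  ⇒*-context (λ vs → F (u ∷ vs)) (λ vs i → compat (u ∷ vs) (suc i)) ts us (args ∘ suc)
  where
  head-⇒* : ∀ {a b} → a ⇒*[ R ] b → F (a ∷ ts) ⇒*[ R ] F (b ∷ ts)
  head-⇒* ε              = ε
  head-⇒* (step ◅ steps) = compat (_ ∷ ts) zero step ◅ head-⇒* steps

module _ (g : Term → Term) where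

  arg-map : ∀ {R} f (ts : Vec Term (arity f)) i {t'} → Step R (g (lookup ts i)) (g t') →
            Step R (fun f (Vec.map g ts)) (fun f (Vec.map g (ts [ i ]≔ t')))
  arg-map {R} f ts i {t'} step =
    subst (λ vs → Step R (fun f (Vec.map g ts)) (fun f vs)) (sym (VecP.map-[]≔ g ts i))
      (arg f (Vec.map g ts) i (subst (λ z → Step R z (g t')) (sym (VecP.lookup-map i g ts)) step))

  map-update-stable : ∀ {n} (ts : Vec Term n) i {t'} → g (lookup ts i) ≡ g t' →
                      Vec.map g (ts [ i ]≔ t') ≡ Vec.map g ts
  map-update-stable ts i {t'} same = begin
    Vec.map g (ts [ i ]≔ t')                    ≡⟨ VecP.map-[]≔ g ts i ⟩
    Vec.map g ts [ i ]≔ g t'                     ≡⟨ cong (Vec.map g ts [ i ]≔_) (sym same) ⟩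
    Vec.map g ts [ i ]≔ g (lookup ts i)          ≡⟨ cong (Vec.map g ts [ i ]≔_) (sym (VecP.lookup-map i g ts)) ⟩
    Vec.map g ts [ i ]≔ lookup (Vec.map g ts) i  ≡⟨ VecP.[]≔-lookup (Vec.map g ts) i ⟩
    Vec.map g ts                                 ∎
    where open ≡-Reasoning

substs-map : ∀ {n} (ts : Vec Term n) σ → substs ts σ ≡ Vec.map (_⟨ σ ⟩) ts
substs-map []       σ = refl
substs-map (t ∷ ts) σ = cong (t ⟨ σ ⟩ ∷_) (substs-map ts σ)

substs-states : ∀ {n} (as : Vec ℕ n) σ → substs (Vec.map st as) σ ≡ Vec.map st as
substs-states []       σ = refl
substs-states (a ∷ as) σ = cong (st a ∷_) (substs-states as σ)

mutual
  ⟨⟩-compose : ∀ t σ τ → (t ⟨ σ ⟩) ⟨ τ ⟩ ≡ t ⟨ (λ x → σ x ⟨ τ ⟩) ⟩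
  ⟨⟩-compose (var x)    σ τ = refl
  ⟨⟩-compose (fun f ts) σ τ = cong (fun f) (substs-compose ts σ τ)

  substs-compose : ∀ {n} (ts : Vec Term n) σ τ →
                   substs (substs ts σ) τ ≡ substs ts (λ x → σ x ⟨ τ ⟩)
  substs-compose []       σ τ = refl
  substs-compose (t ∷ ts) σ τ = cong₂ _∷_ (⟨⟩-compose t σ τ) (substs-compose ts σ τ)

mutual
  ⟨⟩-id : ∀ t σ → (∀ x → x ∈ vars t → σ x ≡ var x) → t ⟨ σ ⟩ ≡ t
  ⟨⟩-id (var x)    σ id-on = id-on x (here refl)
  ⟨⟩-id (fun f ts) σ id-on = cong (fun f) (substs-id ts σ id-on)

  substs-id : ∀ {n} (ts : Vec Term n) σ → (∀ x → x ∈ varss ts → σ x ≡ var x) → substs ts σ ≡ ts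
  substs-id []       σ id-on = refl
  substs-id (t ∷ ts) σ id-on =
    cong₂ _∷_ (⟨⟩-id t σ (λ x → id-on x ∘ ∈P.∈-++⁺ˡ))
              (substs-id ts σ (λ x → id-on x ∘ ∈P.∈-++⁺ʳ (vars t)))

mutual
  symbols-⟨⟩ : ∀ t σ {K : List Sym} → symbols t ⊆ K → (∀ x → symbols (σ x) ⊆ K) →
               symbols (t ⟨ σ ⟩) ⊆ K
  symbols-⟨⟩ (var x)    σ t⊆K σ⊆K = σ⊆K x
  symbols-⟨⟩ (fun f ts) σ t⊆K σ⊆K (here refl) = t⊆K (here refl)
  symbols-⟨⟩ (fun f ts) σ t⊆K σ⊆K (there g∈)  = symbolss-⟨⟩ ts σ (t⊆K ∘ there) σ⊆K g∈

  symbolss-⟨⟩ : ∀ {n} (ts : Vec Term n) σ {K : List Sym} → symbolss ts ⊆ K →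
                (∀ x → symbols (σ x) ⊆ K) → symbolss (substs ts σ) ⊆ K
  symbolss-⟨⟩ (t ∷ ts) σ ts⊆K σ⊆K g∈ with ∈P.∈-++⁻ (symbols (t ⟨ σ ⟩)) g∈
  ... | inj₁ g∈t  = symbols-⟨⟩ t σ (ts⊆K ∘ ∈P.∈-++⁺ˡ) σ⊆K g∈t
  ... | inj₂ g∈ts = symbolss-⟨⟩ ts σ (ts⊆K ∘ ∈P.∈-++⁺ʳ (symbols t)) σ⊆K g∈ts

mutual
  vars-⟨⟩ : ∀ t σ → (∀ x → vars (σ x) ≡ []) → vars (t ⟨ σ ⟩) ≡ []
  vars-⟨⟩ (var x)    σ ground = ground x
  vars-⟨⟩ (fun f ts) σ ground = varss-⟨⟩ ts σ ground

  varss-⟨⟩ : ∀ {n} (ts : Vec Term n) σ → (∀ x → vars (σ x) ≡ []) → varss (substs ts σ) ≡ []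
  varss-⟨⟩ []       σ ground = refl
  varss-⟨⟩ (t ∷ ts) σ ground rewrite vars-⟨⟩ t σ ground = varss-⟨⟩ ts σ ground

Step-⟨⟩ : ∀ {R t t'} τ → Step R t t' → Step R (t ⟨ τ ⟩) (t' ⟨ τ ⟩)
Step-⟨⟩ {R} τ (root {ρ} ρ∈R σ) =
  subst₂ (Step R) (sym (⟨⟩-compose (lhs ρ) σ τ)) (sym (⟨⟩-compose (rhs ρ) σ τ)) (root ρ∈R _)
Step-⟨⟩ {R} τ (arg f ts i {t'} step) =
  subst₂ (λ us vs → Step R (fun f us) (fun f vs)) (sym (substs-map ts τ)) (sym (substs-map _ τ))
    (arg-map (_⟨ τ ⟩) f ts i (Step-⟨⟩ τ step))

⇒*-⟨⟩ : ∀ {R t t'} τ → t ⇒*[ R ] t' → (t ⟨ τ ⟩) ⇒*[ R ] (t' ⟨ τ ⟩)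
⇒*-⟨⟩ τ ε              = ε
⇒*-⟨⟩ τ (step ◅ steps) = Step-⟨⟩ τ step ◅ ⇒*-⟨⟩ τ steps

-- If h leaves the
-- symbols of R alone, Φ commutes with the instances of the rules and hence
-- maps every R-step to at most one R-step.
module Renaming (h : Sym → Maybe Term) where

  replaceOr : Maybe Term → Term → Term
  replaceOr (just u) _ = u
  replaceOr nothing  t = t

  mutual
    Φ : Term → Term
    Φ (var x)    = var x
    Φ (fun f ts) = replaceOr (h f) (fun f (Φs ts))

    Φs : ∀ {n} → Vec Term n → Vec Term n
    Φs []       = []
    Φs (t ∷ ts) = Φ t ∷ Φs ts

  Φs-map : ∀ {n} (ts : Vec Term n) → Φs ts ≡ Vec.map Φ ts
  Φs-map []       = refl
  Φs-map (t ∷ ts) = cong (Φ t ∷_) (Φs-map ts)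

  Keeps : List Sym → Set
  Keeps fs = ∀ f → f ∈ fs → h f ≡ nothing

  mutual
    Φ-id : ∀ t → Keeps (symbols t) → Φ t ≡ t
    Φ-id (var x)    keeps = refl
    Φ-id (fun f ts) keeps rewrite keeps f (here refl) =
      cong (fun f) (Φs-id ts (λ g → keeps g ∘ there))

    Φs-id : ∀ {n} (ts : Vec Term n) → Keeps (symbolss ts) → Φs ts ≡ ts
    Φs-id []       keeps = refl
    Φs-id (t ∷ ts) keeps = cong₂ _∷_ (Φ-id t (λ g → keeps g ∘ ∈P.∈-++⁺ˡ))
                                     (Φs-id ts (λ g → keeps g ∘ ∈P.∈-++⁺ʳ (symbols t)))

  mutual
    Φ-⟨⟩ : ∀ t σ → Keeps (symbols t) → Φ (t ⟨ σ ⟩) ≡ t ⟨ Φ ∘ σ ⟩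
    Φ-⟨⟩ (var x)    σ keeps = refl
    Φ-⟨⟩ (fun f ts) σ keeps rewrite keeps f (here refl) =
      cong (fun f) (Φs-⟨⟩ ts σ (λ g → keeps g ∘ there))

    Φs-⟨⟩ : ∀ {n} (ts : Vec Term n) σ → Keeps (symbolss ts) → Φs (substs ts σ) ≡ substs ts (Φ ∘ σ)
    Φs-⟨⟩ []       σ keeps = refl
    Φs-⟨⟩ (t ∷ ts) σ keeps = cong₂ _∷_ (Φ-⟨⟩ t σ (λ g → keeps g ∘ ∈P.∈-++⁺ˡ))
                                       (Φs-⟨⟩ ts σ (λ g → keeps g ∘ ∈P.∈-++⁺ʳ (symbols t)))

  module _ {R : TRS} (keeps : Keeps (sign R)) where

    Φ-Step : ∀ {t t'} → Step R t t' → Φ t ≡ Φ t' ⊎ Step R (Φ t) (Φ t')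
    Φ-Step (root {ρ} ρ∈R σ) =
      inj₂ (subst₂ (Step R) (sym (Φ-⟨⟩ (lhs ρ) σ (λ f → keeps f ∘ lhs⊆sign R ρ∈R)))
                            (sym (Φ-⟨⟩ (rhs ρ) σ (λ f → keeps f ∘ rhs⊆sign R ρ∈R)))
                            (root ρ∈R (Φ ∘ σ)))
    Φ-Step (arg f ts i {t'} step) with h f | Φ-Step step
    ... | just u  | _ = inj₁ refl
    ... | nothing | inj₁ same =
      inj₁ (cong (fun f) (sym (trans (Φs-map _) (trans (map-update-stable Φ ts i same) (sym (Φs-map ts))))))
    ... | nothing | inj₂ step' =
      inj₂ (subst₂ (λ us vs → Step R (fun f us) (fun f vs)) (sym (Φs-map ts)) (sym (Φs-map _))
                   (arg-map Φ f ts i step'))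

    Φ-⇒* : ∀ {t t'} → t ⇒*[ R ] t' → Φ t ⇒*[ R ] Φ t'
    Φ-⇒* ε              = ε
    Φ-⇒* (step ◅ steps) = ⇒?⇒⇒* (Φ-Step step) ◅◅ Φ-⇒* steps

-- Run t a says that C evaluates t to the state a;
-- it is the inductive counterpart of  t ⇒*_C a  (run⇒⇒*, ⇒*⇒run), and the
-- form in which the intersection test below manipulates reductions.
module Runs {Σ' : Alphabet} (C : BTA Σ') where
  open BTA C

  data Run : Term → ℕ → Set where
    at-state : ∀ a → Run (st a) a
    by-ε     : ∀ {t a a'} (a∈ : a ∈ states) (a'∈ : a' ∈ states) →
               εrule a a' a∈ a'∈ ∈ rules → Run t a → Run t a'
    by-δ     : ∀ δ (δ∈ : δ ∈ Σ') as (as∈ : VAll (_∈ states) as) a (a∈ : a ∈ states) ts →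
               δrule δ δ∈ as as∈ a a∈ ∈ rules →
               (∀ i → Run (lookup ts i) (lookup as i)) → Run (fun δ ts) a

  run⇒⇒* : ∀ {t a} → Run t a → t ⇒*[ asTRS ] st a
  run⇒⇒* (at-state a)          = ε
  run⇒⇒* (by-ε _ _ r∈ run)     = run⇒⇒* run ◅◅ (root (∈P.∈-map⁺ toRule r∈) var ◅ ε)
  run⇒⇒* (by-δ δ _ as _ a _ ts r∈ args) =
    ⇒*-context (fun δ) (arg δ) ts (Vec.map st as) args⇒*states ◅◅ (δ-step ◅ ε)
    where
    args⇒*states : ∀ i → lookup ts i ⇒*[ asTRS ] lookup (Vec.map st as) i
    args⇒*states i =
      subst (lookup ts i ⇒*[ asTRS ]_) (sym (VecP.lookup-map i st as)) (run⇒⇒* (args i))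
    δ-step : Step asTRS (fun δ (Vec.map st as)) (st a)
    δ-step = subst (λ us → Step asTRS (fun δ us) (st a)) (substs-states as var)
                   (root (∈P.∈-map⁺ toRule r∈) var)

  -- A run that starts at a state constant continues a run ending in that state;
  -- no δ-rule applies to a state, since states are not symbols of Σ'.
  run-via-state : ∀ {s a b t} → b ∈ states → Run s a → s ≡ st b → Run t b → Run t a
  run-via-state b∈ (at-state a)         refl run = run
  run-via-state b∈ (by-ε a∈ a'∈ r∈ run) s≡b  run' = by-ε a∈ a'∈ r∈ (run-via-state b∈ run s≡b run')
  run-via-state b∈ (by-δ _ δ∈ _ _ _ _ _ _ _) refl _ = ⊥-elim (disjoint _ b∈ δ∈)

  run-expand-root : ∀ r → r ∈ rules → ∀ σ {a} →
                    Run (rhs (toRule r) ⟨ σ ⟩) a → Run (lhs (toRule r) ⟨ σ ⟩) a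
  run-expand-root (εrule a₀ a₁ a₀∈ a₁∈) r∈ σ run =
    run-via-state a₁∈ run refl (by-ε a₀∈ a₁∈ r∈ (at-state a₀))
  run-expand-root (δrule δ δ∈ as as∈ a₁ a₁∈) r∈ σ run =
    run-via-state a₁∈ run refl (by-δ δ δ∈ as as∈ a₁ a₁∈ _ r∈ args-at-states)
    where
    args-at-states : ∀ i → Run (lookup (substs (Vec.map st as) σ) i) (lookup as i)
    args-at-states i rewrite substs-states as σ | VecP.lookup-map i st as = at-state (lookup as i)

  no-arg-in-state : ∀ {a f} {ts : Vec Term (arity f)} {i t'} → st a ≡ fun f (ts [ i ]≔ t') → ⊥
  no-arg-in-state {i = i} e = FinP.¬Fin0 (subst Fin (sym (cong head-arity e)) i)
    where
    head-arity : Term → ℕ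
    head-arity (var _)   = 1
    head-arity (fun g _) = arity g

  mutual
    run-expand : ∀ {t t' a} → Step asTRS t t' → Run t' a → Run t a
    run-expand (root {ρ} ρ∈ σ) run with ∈P.∈-map⁻ toRule ρ∈
    ... | r , r∈ , refl = run-expand-root r r∈ σ run
    run-expand (arg f ts i step) run = run-expand-arg f ts i step run refl

    run-expand-arg : ∀ f ts i {t'} (step : Step asTRS (lookup ts i) t') {u a} → Run u a →
                     u ≡ fun f (ts [ i ]≔ t') → Run (fun f ts) a
    run-expand-arg f ts i step (at-state a)         e = ⊥-elim (no-arg-in-state e)
    run-expand-arg f ts i step (by-ε a∈ a'∈ r∈ run) e = by-ε a∈ a'∈ r∈ (run-expand-arg f ts i step run e)
    run-expand-arg f ts i {t'} step (by-δ .f δ∈ as as∈ a a∈ .(ts [ i ]≔ t') r∈ args) refl =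
      by-δ f δ∈ as as∈ a a∈ ts r∈ args'
      where
      args' : ∀ j → Run (lookup ts j) (lookup as j)
      args' j with j FinP.≟ i
      ... | yes refl = run-expand step (subst (λ z → Run z (lookup as i)) (VecP.lookup∘update i ts t') (args i))
      ... | no j≢i   = subst (λ z → Run z (lookup as j)) (VecP.lookup∘update′ j≢i ts t') (args j)

  ⇒*⇒run : ∀ {t a} → t ⇒*[ asTRS ] st a → Run t a
  ⇒*⇒run ε              = at-state _
  ⇒*⇒run (step ◅ steps) = run-expand step (⇒*⇒run steps)

-- The number of entries of U still
-- missing from the current list decreases at each round.
module Saturation {A : Set} (_≟_ : DecidableEquality A) (U : List A)
                  (Derives : List A → A → Set) (derives? : ∀ S x → Dec (Derives S x))
                  (Good : A → Set)
                  (derives-good : ∀ S → (∀ x → x ∈ S → Good x) → ∀ x → Derives S x → Good x) where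

  open DecMembership _≟_ using (_∈?_)

  countIfAbsent : ∀ {B : Set} → Dec B → ℕ → ℕ
  countIfAbsent (yes _) n = n
  countIfAbsent (no _)  n = suc n

  missing : List A → List A → ℕ
  missing []       S = 0
  missing (x ∷ xs) S = countIfAbsent (x ∈? S) (missing xs S)

  missing-antitone : ∀ xs {S S′} → S ⊆ S′ → missing xs S′ ≤ missing xs S
  missing-antitone []       S⊆S′ = z≤n
  missing-antitone (x ∷ xs) {S} {S′} S⊆S′ with x ∈? S′ | x ∈? S | missing-antitone xs S⊆S′
  ... | yes _  | yes _  | ≤′ = ≤′
  ... | yes _  | no _   | ≤′ = ℕP.m≤n⇒m≤1+n ≤′
  ... | no x∉  | yes x∈ | _  = contradiction (S⊆S′ x∈) x∉
  ... | no _   | no _   | ≤′ = s≤s ≤′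

  missing-< : ∀ xs {S S′ y} → S ⊆ S′ → y ∈ xs → y ∈ S′ → y ∉ S → missing xs S′ < missing xs S
  missing-< (x ∷ xs) {S} {S′} S⊆S′ (here refl) y∈S′ y∉S with x ∈? S′ | x ∈? S
  ... | _      | yes y∈S = contradiction y∈S y∉S
  ... | yes _  | no _    = s≤s (missing-antitone xs S⊆S′)
  ... | no y∉  | no _    = contradiction y∈S′ y∉
  missing-< (x ∷ xs) {S} {S′} S⊆S′ (there y∈xs) y∈S′ y∉S
    with x ∈? S′ | x ∈? S | missing-< xs S⊆S′ y∈xs y∈S′ y∉S
  ... | yes _  | yes _  | <′ = <′
  ... | yes _  | no _   | <′ = ℕP.m≤n⇒m≤1+n <′
  ... | no x∉  | yes x∈ | _  = contradiction (S⊆S′ x∈) x∉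
  ... | no _   | no _   | <′ = s≤s <′

  record Fixpoint : Set where
    field
      elems  : List A
      good   : ∀ x → x ∈ elems → Good x
      closed : ∀ x → x ∈ U → Derives elems x → x ∈ elems

  saturate-from : ∀ fuel S → missing U S ≤ fuel → (∀ x → x ∈ S → Good x) → Fixpoint
  saturate-from fuel S bound good with any? (λ x → derives? S x ×-dec ¬? (x ∈? S)) U
  ... | no nothing-new = record { elems = S ; good = good ; closed = closed }
    where
    closed : ∀ x → x ∈ U → Derives S x → x ∈ S
    closed x x∈U derived = decidable-stable (x ∈? S) (λ x∉S → nothing-new (lose x∈U (derived , x∉S)))
  ... | yes new with find new
  ... | y , y∈U , (derived , y∉S) = continue fuel bound
    where
    shrinks : missing U (y ∷ S) < missing U S
    shrinks = missing-< U there y∈U (here refl) y∉S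
    good′ : ∀ x → x ∈ y ∷ S → Good x
    good′ x (here refl) = derives-good S good y derived
    good′ x (there x∈S) = good x x∈S
    continue : ∀ fuel → missing U S ≤ fuel → Fixpoint
    continue zero    bound′ = contradiction (ℕP.≤-trans shrinks bound′) λ ()
    continue (suc f) bound′ = saturate-from f (y ∷ S) (ℕP.≤-pred (ℕP.≤-trans shrinks bound′)) good′

  saturate : Fixpoint
  saturate = saturate-from (missing U []) [] ℕP.≤-refl (λ _ ())

-- A pair (a , b) of states is found
-- when some ground term runs to a in C₁ and to b in C₂; the found pairs are the
-- least set closed under the product rules (an ε-rule of either automaton, or
-- δ-rules of both for the same symbol), so they are computed by saturation.
module Intersection {Σ' : Alphabet} (C₁ C₂ : BTA Σ') where
  open BTA
  module R₁ = Runs C₁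
  module R₂ = Runs C₂

  Pair : Set
  Pair = ℕ × ℕ

  _≟P_ : DecidableEquality Pair
  _≟P_ = ≡-dec ℕ._≟_ ℕ._≟_

  open DecMembership _≟P_ using (_∈?_)

  record CommonRun (x : Pair) : Set where
    constructor common
    field
      term   : Term
      ground : Ground Σ' term
      run₁   : R₁.Run term (proj₁ x)
      run₂   : R₂.Run term (proj₂ x)

  ε₁-derives : List Pair → Pair → BRule Σ' (states C₁) → Set
  ε₁-derives S (a , b) (εrule a₀ a′ _ _)   = a′ ≡ a × (a₀ , b) ∈ S
  ε₁-derives S (a , b) (δrule _ _ _ _ _ _) = ⊥

  ε₂-derives : List Pair → Pair → BRule Σ' (states C₂) → Set
  ε₂-derives S (a , b) (εrule b₀ b′ _ _)   = b′ ≡ b × (a , b₀) ∈ S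
  ε₂-derives S (a , b) (δrule _ _ _ _ _ _) = ⊥

  δ-derives : List Pair → Pair → BRule Σ' (states C₁) → BRule Σ' (states C₂) → Set
  δ-derives S (a , b) (δrule f _ as _ a′ _) (δrule g _ bs _ b′ _) =
    f ≡ g × a′ ≡ a × b′ ≡ b × Pointwise.Pointwise (λ x y → (x , y) ∈ S) as bs
  δ-derives S (a , b) (δrule _ _ _ _ _ _) (εrule _ _ _ _) = ⊥
  δ-derives S (a , b) (εrule _ _ _ _)     _               = ⊥

  Derives : List Pair → Pair → Set
  Derives S x = Any (ε₁-derives S x) (rules C₁) ⊎ Any (ε₂-derives S x) (rules C₂) ⊎
                Any (λ r₁ → Any (δ-derives S x r₁) (rules C₂)) (rules C₁)

  derives? : ∀ S x → Dec (Derives S x)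
  derives? S x = any? ε₁? (rules C₁) ⊎-dec any? ε₂? (rules C₂) ⊎-dec
                 any? (λ r₁ → any? (δ? r₁) (rules C₂)) (rules C₁)
    where
    ε₁? : ∀ r → Dec (ε₁-derives S x r)
    ε₁? (εrule a₀ a′ _ _)   = (a′ ℕ.≟ proj₁ x) ×-dec ((a₀ , proj₂ x) ∈? S)
    ε₁? (δrule _ _ _ _ _ _) = no λ ()
    ε₂? : ∀ r → Dec (ε₂-derives S x r)
    ε₂? (εrule b₀ b′ _ _)   = (b′ ℕ.≟ proj₂ x) ×-dec ((proj₁ x , b₀) ∈? S)
    ε₂? (δrule _ _ _ _ _ _) = no λ ()
    δ? : ∀ r₁ r₂ → Dec (δ-derives S x r₁ r₂)
    δ? (δrule f _ as _ a′ _) (δrule g _ bs _ b′ _) =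
      f ≟S g ×-dec a′ ℕ.≟ proj₁ x ×-dec b′ ℕ.≟ proj₂ x ×-dec
      Pointwise.decidable (λ a b → (a , b) ∈? S) as bs
    δ? (δrule _ _ _ _ _ _) (εrule _ _ _ _) = no λ ()
    δ? (εrule _ _ _ _)     _               = no λ ()

  common-fun : ∀ {δ δ∈ δ∈′ as as∈ bs bs∈ a a∈ b b∈} →
               δrule δ δ∈ as as∈ a a∈ ∈ rules C₁ → δrule δ δ∈′ bs bs∈ b b∈ ∈ rules C₂ →
               (∀ i → CommonRun (lookup as i , lookup bs i)) → CommonRun (a , b)
  common-fun {δ} {δ∈} {δ∈′} {as} {as∈} {bs} {bs∈} {a} {a∈} {b} {b∈} r₁∈ r₂∈ args =
    common (fun δ ts) (ground-fun δ ts δ∈ (at-tabulate (λ _ → Ground Σ') _ (CommonRun.ground ∘ args)))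
      (R₁.by-δ δ δ∈ as as∈ a a∈ ts r₁∈ (at-tabulate (λ i t → R₁.Run t (lookup as i)) _ (CommonRun.run₁ ∘ args)))
      (R₂.by-δ δ δ∈′ bs bs∈ b b∈ ts r₂∈ (at-tabulate (λ i t → R₂.Run t (lookup bs i)) _ (CommonRun.run₂ ∘ args)))
    where
    ts : Vec Term (arity δ)
    ts = Vec.tabulate (CommonRun.term ∘ args)

  derives-common : ∀ S → (∀ x → x ∈ S → CommonRun x) → ∀ x → Derives S x → CommonRun x
  derives-common S known x (inj₁ ε₁) with find ε₁
  ... | εrule _ _ a₀∈ a′∈ , r∈ , (refl , x₀∈S) with known _ x₀∈S
  ...   | common t g run₁ run₂ = common t g (R₁.by-ε a₀∈ a′∈ r∈ run₁) run₂
  derives-common S known x (inj₂ (inj₁ ε₂)) with find ε₂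
  ... | εrule _ _ b₀∈ b′∈ , r∈ , (refl , x₀∈S) with known _ x₀∈S
  ...   | common t g run₁ run₂ = common t g run₁ (R₂.by-ε b₀∈ b′∈ r∈ run₂)
  derives-common S known x (inj₂ (inj₂ δδ)) with find δδ
  ... | r₁ , r₁∈ , δ₂ with find δ₂
  ...   | r₂ , r₂∈ , derived = from-δ-rules r₁ r₂ r₁∈ r₂∈ derived
    where
    from-δ-rules : ∀ r₁ r₂ → r₁ ∈ rules C₁ → r₂ ∈ rules C₂ → δ-derives S x r₁ r₂ → CommonRun x
    from-δ-rules (δrule _ _ _ _ _ _) (δrule _ _ _ _ _ _) r₁∈ r₂∈ (refl , refl , refl , args) =
      common-fun r₁∈ r₂∈ (λ i → known _ (Pointwise.lookup args i))

  module Found = Saturation _≟P_ (List.cartesianProduct (states C₁) (states C₂))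
                             Derives derives? CommonRun derives-common
  open Found.Fixpoint Found.saturate renaming (elems to found; good to found-common)

  common⇒found : ∀ {t a b} → InT Σ' t → a ∈ states C₁ → b ∈ states C₂ →
                 R₁.Run t a → R₂.Run t b → (a , b) ∈ found
  common⇒found t∈ a∈ b∈ (R₁.at-state a) _ = ⊥-elim (disjoint C₁ a a∈ (t∈ (here refl)))
  common⇒found t∈ a∈ b∈ (R₁.by-ε a₀∈ _ r∈ run₁) run₂ =
    closed _ (∈P.∈-cartesianProduct⁺ a∈ b∈) (inj₁ (lose r∈ (refl , common⇒found t∈ a₀∈ b∈ run₁ run₂)))
  common⇒found t∈ a∈ b∈ (R₁.by-δ _ _ _ _ _ _ _ _ _) (R₂.at-state b) =
    ⊥-elim (disjoint C₂ b b∈ (t∈ (here refl)))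
  common⇒found t∈ a∈ b∈ run₁@(R₁.by-δ _ _ _ _ _ _ _ _ _) (R₂.by-ε b₀∈ _ r∈ run₂) =
    closed _ (∈P.∈-cartesianProduct⁺ a∈ b∈)
      (inj₂ (inj₁ (lose r∈ (refl , common⇒found t∈ a∈ b₀∈ run₁ run₂))))
  common⇒found t∈ a∈ b∈ (R₁.by-δ δ _ as as∈ _ _ ts r₁∈ args₁) (R₂.by-δ .δ _ bs bs∈ _ _ .ts r₂∈ args₂) =
    closed _ (∈P.∈-cartesianProduct⁺ a∈ b∈)
      (inj₂ (inj₂ (lose r₁∈ (lose r₂∈ (refl , refl , refl , extensional⇒inductive (ext args-found))))))
    where
    args-found : ∀ i → (lookup as i , lookup bs i) ∈ found
    args-found i = common⇒found (t∈ ∘ there ∘ symbols-lookup ts i)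
                     (VAllP.lookup⁺ as∈ i) (VAllP.lookup⁺ bs∈ i) (args₁ i) (args₂ i)

  FinalFound : Set
  FinalFound = Any (λ a → Any (λ b → (a , b) ∈ found) (final C₂)) (final C₁)

  finalFound⇒nonempty : FinalFound → ∃[ t ] (Accepts C₁ t × Accepts C₂ t)
  finalFound⇒nonempty final-pair with find final-pair
  ... | a , a∈ , finals with find finals
  ...   | b , b∈ , ab∈ with found-common _ ab∈
  ...     | common t g run₁ run₂ = t , (g , a , a∈ , R₁.run⇒⇒* run₁) , (g , b , b∈ , R₂.run⇒⇒* run₂)

  nonempty⇒finalFound : ∃[ t ] (Accepts C₁ t × Accepts C₂ t) → FinalFound
  nonempty⇒finalFound (t , (g , a , a∈ , t⇒*a) , (_ , b , b∈ , t⇒*b)) =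
    lose a∈ (lose b∈ (common⇒found (proj₁ g) (final⊆ C₁ a∈) (final⊆ C₂ b∈)
                                    (R₁.⇒*⇒run t⇒*a) (R₂.⇒*⇒run t⇒*b)))

  intersection? : Dec (∃[ t ] (Accepts C₁ t × Accepts C₂ t))
  intersection? = map′ finalFound⇒nonempty nonempty⇒finalFound
                    (any? (λ a → any? (λ b → (a , b) ∈? found) (final C₂)) (final C₁))

-- Confluence is only assumed on T_Σ'(X),
-- but a conversion may pass through terms with foreign symbols.  The
-- projection π replaces every subterm headed by a symbol outside Σ' by a
-- variable: it keeps sign(R) ⊆ Σ', so it maps the conversion to one inside
-- T_Σ'(X), where confluence turns it into a join.
module ChurchRosser (Σ' : Alphabet) (R : TRS) (over : TRSOver Σ' R) (conf : Confluent Σ' R) where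

  foreign : Sym → Maybe Term
  foreign f with f ∈S? Σ'
  ... | yes _ = nothing
  ... | no _  = just (var 0)

  open Renaming foreign renaming (Φ to π; Φs to πs)

  keeps-Σ' : Keeps Σ'
  keeps-Σ' f f∈ with f ∈S? Σ'
  ... | yes _ = refl
  ... | no f∉ = contradiction f∈ f∉

  mutual
    π-in : ∀ t → InT Σ' (π t)
    π-in (fun f ts) g∈ with f ∈S? Σ'
    π-in (fun f ts) (here refl) | yes f∈ = f∈
    π-in (fun f ts) (there g∈)  | yes _  = πs-in ts g∈

    πs-in : ∀ {n} (ts : Vec Term n) → symbolss (πs ts) ⊆ Σ'
    πs-in (t ∷ ts) g∈ with ∈P.∈-++⁻ (symbols (π t)) g∈
    ... | inj₁ g∈t  = π-in t g∈t
    ... | inj₂ g∈ts = πs-in ts g∈ts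

  π-⇒* : ∀ {s t} → s ⇒*[ R ] t → π s ⇒*[ R ] π t
  π-⇒* = Φ-⇒* (λ f → keeps-Σ' f ∘ over)

  π-id : ∀ {t} → InT Σ' t → π t ≡ t
  π-id {t} t∈ = Φ-id t (λ f → keeps-Σ' f ∘ t∈)

  convertible⇒π-joinable : ∀ {s t} → s ⇔*[ R ] t → Joinable R (π s) (π t)
  convertible⇒π-joinable ε = _ , ε , ε
  convertible⇒π-joinable (fwd step ◅ conv) with convertible⇒π-joinable conv
  ... | u , s₁⇒*u , t⇒*u = u , π-⇒* (step ◅ ε) ◅◅ s₁⇒*u , t⇒*u
  convertible⇒π-joinable {s} (_◅_ {j = s₁} (bwd step) conv) with convertible⇒π-joinable conv
  ... | u , s₁⇒*u , t⇒*u with conf (π s₁) u (π s) (π-in s₁) s₁⇒*u (π-⇒* (step ◅ ε))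
  ...   | w , u⇒*w , s⇒*w = w , s⇒*w , t⇒*u ◅◅ u⇒*w

  church-rosser : ∀ {s t} → InT Σ' s → InT Σ' t → Joinable R s t ⇔ s ⇔*[ R ] t
  church-rosser s∈ t∈ =
    mk⇔ joinable⇒convertible (subst₂ (Joinable R) (π-id s∈) (π-id t∈) ∘ convertible⇒π-joinable)

-- The constant for x is named N + x
-- for an N exceeding every name in Σ'; variables above the bound M are
-- frozen like M, which keeps the extended alphabet Σ̂ finite.  Thawing ν maps
-- each symbol named N + x back to the variable x; it keeps Σ' (hence sign R)
-- and undoes freezing on terms over Σ' whose variables are at most M.
module Freezing (Σ' : Alphabet) (R : TRS) (over : TRSOver Σ' R) (M : ℕ) where

  N : ℕ
  N = suc (max 0 (List.map name Σ'))

  name<N : ∀ {f} → f ∈ Σ' → name f < N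
  name<N f∈ = s≤s (All.lookup (xs≤max 0 _) (∈P.∈-map⁺ name f∈))

  frozen : ℕ → Sym
  frozen x = mkSym (N + x) 0

  κ : Subst
  κ x = fun (frozen (x ⊓ M)) []

  Σ̂ : Alphabet
  Σ̂ = Σ' ++ List.map frozen (List.upTo (suc M))

  sign⊆Σ̂ : sign R ⊆ Σ̂
  sign⊆Σ̂ = ∈P.∈-++⁺ˡ ∘ over

  ground-frozen : ∀ t → InT Σ' t → Ground Σ̂ (t ⟨ κ ⟩)
  ground-frozen t t∈ = symbols-⟨⟩ t κ (∈P.∈-++⁺ˡ ∘ t∈) κ-in , vars-⟨⟩ t κ (λ _ → refl)
    where
    κ-in : ∀ x → symbols (κ x) ⊆ Σ̂
    κ-in x (here refl) = ∈P.∈-++⁺ʳ Σ' (∈P.∈-map⁺ frozen (∈P.∈-upTo⁺ (s≤s (ℕP.m⊓n≤n x M))))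

  thaw : Sym → Maybe Term
  thaw f with N ℕ.≤? name f
  ... | yes _ = just (var (name f ∸ N))
  ... | no _  = nothing

  open Renaming thaw renaming (Φ to ν)

  keeps-Σ' : Keeps Σ'
  keeps-Σ' f f∈ with N ℕ.≤? name f
  ... | yes N≤f = contradiction N≤f (ℕP.<⇒≱ (name<N f∈))
  ... | no _    = refl

  ν-κ : ∀ x → x ≤ M → ν (κ x) ≡ var x
  ν-κ x x≤M with N ℕ.≤? (N + x ⊓ M)
  ... | yes _ = cong var (trans (ℕP.m+n∸m≡n N (x ⊓ M)) (ℕP.m≤n⇒m⊓n≡m x≤M))
  ... | no N≰ = contradiction (ℕP.m≤m+n N _) N≰

  thaw-freeze : ∀ t → InT Σ' t → (∀ x → x ∈ vars t → x ≤ M) → ν (t ⟨ κ ⟩) ≡ t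
  thaw-freeze t t∈ vars≤M = begin
    ν (t ⟨ κ ⟩)      ≡⟨ Φ-⟨⟩ t κ (λ f → keeps-Σ' f ∘ t∈) ⟩
    t ⟨ ν ∘ κ ⟩      ≡⟨ ⟨⟩-id t (ν ∘ κ) (λ x → ν-κ x ∘ vars≤M x) ⟩
    t                ∎
    where open ≡-Reasoning

  freezing : ∀ {s t} → InT Σ' s → InT Σ' t →
             (∀ x → x ∈ vars s → x ≤ M) → (∀ x → x ∈ vars t → x ≤ M) →
             Joinable R (s ⟨ κ ⟩) (t ⟨ κ ⟩) ⇔ Joinable R s t
  freezing {s} {t} s∈ t∈ s≤M t≤M = mk⇔ thaw-join (λ (u , s⇒*u , t⇒*u) → u ⟨ κ ⟩ , ⇒*-⟨⟩ κ s⇒*u , ⇒*-⟨⟩ κ t⇒*u)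
    where
    thaw-join : Joinable R (s ⟨ κ ⟩) (t ⟨ κ ⟩) → Joinable R s t
    thaw-join (u , ŝ⇒*u , t̂⇒*u) =
      ν u , subst (_⇒*[ R ] ν u) (thaw-freeze s s∈ s≤M) (Φ-⇒* keeps-R ŝ⇒*u)
          , subst (_⇒*[ R ] ν u) (thaw-freeze t t∈ t≤M) (Φ-⇒* keeps-R t̂⇒*u)
      where
      keeps-R : Keeps (sign R)
      keeps-R f = keeps-Σ' f ∘ over

Recognises : ∀ {Σ'} → TRS → BTA Σ' → Term → Set
Recognises R C s = ∀ u → (Accepts C u → Descendant R (s ∷ []) u) × (Descendant R (s ∷ []) u → Accepts C u)

joinable-by-automata : ∀ {Σ' R s t} {Cs Ct : BTA Σ'} → Recognises R Cs s → Recognises R Ct t →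
                       (∃[ u ] (Accepts Cs u × Accepts Ct u)) ⇔ Joinable R s t
joinable-by-automata {R = R} {s} {t} Cs-desc Ct-desc =
  mk⇔ (λ (u , s-acc , t-acc) → u , single (proj₁ (Cs-desc u) s-acc) , single (proj₁ (Ct-desc u) t-acc))
      (λ (u , s⇒*u , t⇒*u) → u , proj₂ (Cs-desc u) (s , here refl , s⇒*u)
                               , proj₂ (Ct-desc u) (t , here refl , t⇒*u))
  where
  single : ∀ {r u} → Descendant R (r ∷ []) u → r ⇒*[ R ] u
  single (_ , here refl , r⇒*u) = r⇒*u

mainTheorem5 : (Σ' : Alphabet) (R : TRS) → TRSOver Σ' R → Confluent Σ' R → EPRF R →
    (p q : Term) → InT Σ' p → InT Σ' q → Dec (p ⇔*[ R ] q)
mainTheorem5 Σ' R over conf eprf p q p∈ q∈ =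
  Dec.map (church-rosser p∈ q∈)
    (Dec.map (freezing p∈ q∈ (λ _ → ≤M ∘ ∈P.∈-++⁺ˡ) (λ _ → ≤M ∘ ∈P.∈-++⁺ʳ (vars p)))
      (Dec.map (joinable-by-automata {Cs = proj₁ C₁} {Ct = proj₁ C₂} (proj₂ C₁) (proj₂ C₂))
        (Intersection.intersection? (proj₁ C₁) (proj₁ C₂))))
  where
  open ChurchRosser Σ' R over conf using (church-rosser)
  M : ℕ
  M = max 0 (vars p ++ vars q)
  open Freezing Σ' R over M
  ≤M : ∀ {x} → x ∈ vars p ++ vars q → x ≤ M
  ≤M = All.lookup (xs≤max 0 _)
  C₁ : Σ (BTA Σ̂) λ C → Recognises R C (p ⟨ κ ⟩)
  C₁ = eprf Σ̂ sign⊆Σ̂ (p ⟨ κ ⟩ ∷ []) (ground-frozen p p∈ ∷ [])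
  C₂ : Σ (BTA Σ̂) λ C → Recognises R C (q ⟨ κ ⟩)
  C₂ = eprf Σ̂ sign⊆Σ̂ (q ⟨ κ ⟩ ∷ []) (ground-frozen q q∈ ∷ [])
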